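{- For each sequence $x\in\{a,b,c,d\}$ of optimal move counts of the parity-constrained four-peg Tower of Hanoi, $x_n=\Theta\big((\sqrt2)^n\big)$ as $n\to\infty$.
   Context: Parity-constrained four-peg Tower of Hanoi with $n$ discs labelled $1,\dots,n$ (disc $1$ smallest). Four pegs $N_1,E,O,N_2$: $N_1,N_2$ neutral, $E$ only for even-labelled discs, $O$ only for odd-labelled discs. A state places every disc on a parity-compatible peg with discs increasing from top to bottom on each peg. A legal move takes the top disc $d$ of a peg $p$ to a peg $q\ne p$ that is empty or has a larger top disc, with both $p,q$ allowed for the parity of $d$. Starting from all discs on $N_1$: $a_n$ is the minimum number of moves to bring all discs to $N_2$; $b_n$ to reach all even discs on $E$ and all odd on $O$; $c_n$ to reach all odd discs on $O$ and all even on $N_2$; $d_n$ to reach all odd discs on $N_2$ and all even on $E$. -}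

module Defs where

open import Data.Nat using (ℕ; zero; suc; _+_; _*_; _^_; _≤_; _<_)
open import Data.Bool using (Bool; true; false; not; T)
open import Data.Unit using (⊤)
open import Data.Fin using (Fin; toℕ)
open import Data.Vec using (Vec; replicate; tabulate; lookup; _[_]≔_)
open import Data.Product using (Σ; ∃; _×_; _,_)
open import Relation.Binary.PropositionalEquality using (_≡_; _≢_)
open import Relation.Nullary using (¬_)

data Peg : Set where
  N₁ E O N₂ : Peg

isEven : ℕ → Bool
isEven zero = true
isEven (suc n) = not (isEven n)

-- Disc i : Fin n carries the label (toℕ i + 1); label 1 is the smallest disc.
label : ∀ {n} → Fin n → ℕ
label i = suc (toℕ i)

Allowed : ∀ {n} → Fin n → Peg → Set
Allowed d N₁ = ⊤
Allowed d E  = T (isEven (label d))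
Allowed d O  = T (not (isEven (label d)))
Allowed d N₂ = ⊤

-- A state records the peg of every disc; on each peg the discs are stacked
-- in increasing order of label (smallest on top), so this determines the
-- configuration completely.
State : ℕ → Set
State n = Vec Peg n

-- A legal single move from s to t: disc d moves from its peg p = s[d] to q ≠ p,
-- d is the top disc of p (no smaller disc on p), q is empty or its top disc is
-- larger than d (no smaller disc on q), and q is allowed for the parity of d.
-- (p is allowed for d since all reachable states from a valid start are valid.)
data Move {n : ℕ} (s t : State n) : Set where
  move : (d : Fin n) (q : Peg) →
         lookup s d ≢ q →
         Allowed d q →
         (∀ (e : Fin n) → toℕ e < toℕ d → lookup s e ≢ lookup s d) →
         (∀ (e : Fin n) → toℕ e < toℕ d → lookup s e ≢ q) →
         t ≡ s [ d ]≔ q →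
         Move s t

data Moves {n : ℕ} : ℕ → State n → State n → Set where
  done : ∀ {s} → Moves 0 s s
  step : ∀ {k s t u} → Move s t → Moves k t u → Moves (suc k) s u

start : (n : ℕ) → State n
start n = replicate n N₁

data Goal : Set where
  goalA goalB goalC goalD : Goal

targetPeg : Goal → Bool → Peg   -- second argument: is the label even?
targetPeg goalA _     = N₂
targetPeg goalB true  = E
targetPeg goalB false = O
targetPeg goalC true  = N₂
targetPeg goalC false = O
targetPeg goalD true  = E
targetPeg goalD false = N₂

target : Goal → (n : ℕ) → State n
target g n = tabulate (λ i → targetPeg g (isEven (label i)))

Optimal : Goal → ℕ → ℕ → Set
Optimal g n k = Moves k (start n) (target g n)
              × (∀ j → j < k → ¬ Moves j (start n) (target g n))

-- The odd-labelled discs never use E, so by themselves they play a legal game of the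
-- classical three-peg Tower of Hanoi on N₁, O, N₂ (an even disc may block them but never
-- moves them).  The classical distance of their configuration to the perfect tower on their
-- final peg drops by at most one per move; it is 2 ^ ⌈ n /2⌉ − 1 at the start and 0 at every
-- goal, so k ≥ 2 ^ ⌈ n /2⌉ − 1.  Conversely, the discs of one parity can be moved between
-- their three pegs by the classical recursion, at cost 2 ^ (their number) − 1, while the
-- discs of the other parity rest at their home peg E or O.  Bringing the discs home one at
-- a time then costs O(2 ^ (k / 2)) for disc k, so every goal is reached in O(2 ^ (n / 2))
-- moves.  Hence k ² lies between constant multiples of 2 ^ n; an optimal k exists because
-- reachability in j moves is decidable.

module Submission where

open import Defs
open import Data.Nat using (ℕ; _*_; _^_; _≤_)
open import Data.Product using (Σ; ∃; _×_; _,_)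

import Data.Bool as Bool
open import Data.Bool using (Bool; true; false; not; T)
open import Data.Bool.Properties using (not-involutive; not-¬; ¬-not)
open import Data.Empty using (⊥-elim)
import Data.Fin as Fin
open import Data.Fin using (Fin; toℕ; fromℕ<) renaming (zero to fzero; suc to fsuc)
open import Data.Fin.Properties using (toℕ-fromℕ<; toℕ-injective; toℕ<n; all?; any?)
open import Data.Nat using (zero; suc; _+_; _<_; z≤n; s≤s; s≤s⁻¹; _<?_; ⌊_/2⌋; ⌈_/2⌉)
open import Data.Nat.Properties hiding (_≟_)
open import Algebra.Properties.CommutativeSemigroup *-commutativeSemigroup using (interchange)
open import Data.Nat.Tactic.RingSolver using (solve-∀)
open import Data.Product using (proj₁; proj₂)
open import Data.Sum using (_⊎_; inj₁; inj₂; [_,_]′)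
open import Data.Unit using (tt)
open import Data.Vec using ([]; _∷_; replicate; tabulate; lookup; _[_]≔_)
open import Data.Vec.Properties
  using (lookup-replicate; lookup∘tabulate; lookup∘update; lookup∘update′; tabulate∘lookup; tabulate-cong; ≡-dec)
open import Function using (_∘_)
open import Relation.Binary.Definitions using (DecidableEquality)
open import Relation.Binary.PropositionalEquality
open import Relation.Nullary using (¬_; Dec; yes; no)
open import Relation.Nullary.Decidable using (¬?; _×-dec_; _→-dec_; T?)
open import Relation.Unary using (Decidable)

_≟_ : DecidableEquality Peg
N₁ ≟ N₁ = yes refl
N₁ ≟ E  = no λ ()
N₁ ≟ O  = no λ ()
N₁ ≟ N₂ = no λ ()
E  ≟ N₁ = no λ ()
E  ≟ E  = yes refl
E  ≟ O  = no λ ()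
E  ≟ N₂ = no λ ()
O  ≟ N₁ = no λ ()
O  ≟ E  = no λ ()
O  ≟ O  = yes refl
O  ≟ N₂ = no λ ()
N₂ ≟ N₁ = no λ ()
N₂ ≟ E  = no λ ()
N₂ ≟ O  = no λ ()
N₂ ≟ N₂ = yes refl

parity : ℕ → Bool
parity k = isEven (suc k)

parity-suc² : ∀ k → parity (suc (suc k)) ≡ parity k
parity-suc² k = not-involutive (parity k)

parity-drop₂ : ∀ {n e} (d : Fin n) → parity (toℕ (fsuc (fsuc d))) ≡ e → parity (toℕ d) ≡ e
parity-drop₂ d h = trans (sym (parity-suc² (toℕ d))) h

data PegFor : Bool → Peg → Set where
  at-N₁ : ∀ {e} → PegFor e N₁
  at-N₂ : ∀ {e} → PegFor e N₂
  at-E  : PegFor true E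
  at-O  : PegFor false O

pegFor : ∀ {n} {d : Fin n} q → Allowed d q → PegFor (parity (toℕ d)) q
pegFor N₁ _ = at-N₁
pegFor N₂ _ = at-N₂
pegFor {d = d} E ok with parity (toℕ d)
... | true  = at-E
... | false = ⊥-elim ok
pegFor {d = d} O ok with parity (toℕ d)
... | true  = ⊥-elim ok
... | false = at-O

allowed : ∀ {n} {d : Fin n} {e q} → PegFor e q → parity (toℕ d) ≡ e → Allowed d q
allowed at-N₁ _  = tt
allowed at-N₂ _  = tt
allowed at-E  eq = subst T (sym eq) tt
allowed at-O  eq = subst (T ∘ not) (sym eq) tt

Clear : ∀ {n} → State n → Fin n → Peg → Set
Clear s d p = ∀ e → toℕ e < toℕ d → lookup s e ≢ p

_++ᴹ_ : ∀ {n j k} {s t u : State n} → Moves j s t → Moves k t u → Moves (j + k) s u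
done      ++ᴹ ms′ = ms′
step m ms ++ᴹ ms′ = step m (ms ++ᴹ ms′)

arrive : ∀ {n c} {s t : State n} {f : Fin n → Peg} → Moves c s t → (∀ i → lookup t i ≡ f i) →
         Moves c s (tabulate f)
arrive ms t≗f = subst (Moves _ _) (trans (sym (tabulate∘lookup _)) (tabulate-cong t≗f)) ms

-- Lower bound: the odd discs play a three-peg Tower of Hanoi

OddPeg : Peg → Set
OddPeg = PegFor false

-- The odd peg other than p and q; the last clause is junk (p ≡ q, or E involved).
third : Peg → Peg → Peg
third N₁ O  = N₂
third O  N₁ = N₂
third N₁ N₂ = O
third N₂ N₁ = O
third O  N₂ = N₁
third N₂ O  = N₁
third p  _  = p

third-oddPeg : ∀ {p q} → OddPeg p → OddPeg q → OddPeg (third p q)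
third-oddPeg at-N₁ at-N₁ = at-N₁
third-oddPeg at-N₁ at-N₂ = at-O
third-oddPeg at-N₁ at-O  = at-N₂
third-oddPeg at-N₂ at-N₁ = at-O
third-oddPeg at-N₂ at-N₂ = at-N₂
third-oddPeg at-N₂ at-O  = at-N₁
third-oddPeg at-O  at-N₁ = at-N₂
third-oddPeg at-O  at-N₂ = at-N₁
third-oddPeg at-O  at-O  = at-O

third-comm : ∀ {p q} → OddPeg p → OddPeg q → third p q ≡ third q p
third-comm at-N₁ at-N₁ = refl
third-comm at-N₁ at-N₂ = refl
third-comm at-N₁ at-O  = refl
third-comm at-N₂ at-N₁ = refl
third-comm at-N₂ at-N₂ = refl
third-comm at-N₂ at-O  = refl
third-comm at-O  at-N₁ = refl
third-comm at-O  at-N₂ = refl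
third-comm at-O  at-O  = refl

≢-third : ∀ {p q} → OddPeg p → OddPeg q → p ≢ q → p ≢ third p q × q ≢ third p q
≢-third at-N₁ at-N₁ p≢q = ⊥-elim (p≢q refl)
≢-third at-N₁ at-N₂ _   = (λ ()) , (λ ())
≢-third at-N₁ at-O  _   = (λ ()) , (λ ())
≢-third at-N₂ at-N₁ _   = (λ ()) , (λ ())
≢-third at-N₂ at-N₂ p≢q = ⊥-elim (p≢q refl)
≢-third at-N₂ at-O  _   = (λ ()) , (λ ())
≢-third at-O  at-N₁ _   = (λ ()) , (λ ())
≢-third at-O  at-N₂ _   = (λ ()) , (λ ())
≢-third at-O  at-O  p≢q = ⊥-elim (p≢q refl)

oddPeg-cases : ∀ {p q x} → OddPeg p → OddPeg q → p ≢ q → OddPeg x →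
               x ≡ p ⊎ x ≡ q ⊎ x ≡ third p q
oddPeg-cases at-N₁ at-N₁ p≢q _     = ⊥-elim (p≢q refl)
oddPeg-cases at-N₂ at-N₂ p≢q _     = ⊥-elim (p≢q refl)
oddPeg-cases at-O  at-O  p≢q _     = ⊥-elim (p≢q refl)
oddPeg-cases at-N₁ at-N₂ _   at-N₁ = inj₁ refl
oddPeg-cases at-N₁ at-N₂ _   at-N₂ = inj₂ (inj₁ refl)
oddPeg-cases at-N₁ at-N₂ _   at-O  = inj₂ (inj₂ refl)
oddPeg-cases at-N₁ at-O  _   at-N₁ = inj₁ refl
oddPeg-cases at-N₁ at-O  _   at-O  = inj₂ (inj₁ refl)
oddPeg-cases at-N₁ at-O  _   at-N₂ = inj₂ (inj₂ refl)
oddPeg-cases at-N₂ at-N₁ _   at-N₂ = inj₁ refl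
oddPeg-cases at-N₂ at-N₁ _   at-N₁ = inj₂ (inj₁ refl)
oddPeg-cases at-N₂ at-N₁ _   at-O  = inj₂ (inj₂ refl)
oddPeg-cases at-N₂ at-O  _   at-N₂ = inj₁ refl
oddPeg-cases at-N₂ at-O  _   at-O  = inj₂ (inj₁ refl)
oddPeg-cases at-N₂ at-O  _   at-N₁ = inj₂ (inj₂ refl)
oddPeg-cases at-O  at-N₁ _   at-O  = inj₁ refl
oddPeg-cases at-O  at-N₁ _   at-N₁ = inj₂ (inj₁ refl)
oddPeg-cases at-O  at-N₁ _   at-N₂ = inj₂ (inj₂ refl)
oddPeg-cases at-O  at-N₂ _   at-O  = inj₁ refl
oddPeg-cases at-O  at-N₂ _   at-N₂ = inj₂ (inj₁ refl)
oddPeg-cases at-O  at-N₂ _   at-N₁ = inj₂ (inj₂ refl)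

-- For the odd-labelled discs of s (positions 0, 2, 4, …), viewed as a three-peg configuration,
-- potential s Y = (D , T): D is the classical number of moves needed to gather them on Y, and
-- T the peg that a still smaller odd disc would have to reach; push x accounts for such a
-- disc lying on x.
push : Peg → ℕ × Peg → ℕ × Peg
push x (D , T) with x ≟ T
... | yes _ = 2 * D , T
... | no  _ = suc (2 * D) , third x T

push-≡ : ∀ x D → push x (D , x) ≡ (2 * D , x)
push-≡ x D with x ≟ x
... | yes _   = refl
... | no  x≢x = ⊥-elim (x≢x refl)

push-≢ : ∀ {x T} D → x ≢ T → push x (D , T) ≡ (suc (2 * D) , third x T)
push-≢ {x} {T} D x≢T with x ≟ T
... | yes x≡T = ⊥-elim (x≢T x≡T)
... | no  _   = refl

push-oddPeg : ∀ {x} a → OddPeg x → OddPeg (proj₂ a) → OddPeg (proj₂ (push x a))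
push-oddPeg {x} (D , T) ox oT with x ≟ T
... | yes _ = oT
... | no  _ = third-oddPeg ox oT

potential : ∀ {n} → State n → Peg → ℕ × Peg
potential []          Y = 0 , Y
potential (x ∷ [])    Y = push x (0 , Y)
potential (x ∷ _ ∷ s) Y = push x (potential s Y)

distance : ∀ {n} → State n → Peg → ℕ
distance s Y = proj₁ (potential s Y)

OddDiscsOnOddPegs : ∀ {n} → State n → Set
OddDiscsOnOddPegs s = ∀ i → parity (toℕ i) ≡ false → OddPeg (lookup s i)

oddDiscs-drop₂ : ∀ {n x y} {s : State n} → OddDiscsOnOddPegs (x ∷ y ∷ s) → OddDiscsOnOddPegs s
oddDiscs-drop₂ odd i h = odd (fsuc (fsuc i)) (trans (parity-suc² (toℕ i)) h)

potential-oddPeg : ∀ {n} (s : State n) {Y} → OddDiscsOnOddPegs s → OddPeg Y → OddPeg (proj₂ (potential s Y))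
potential-oddPeg []          odd oY = oY
potential-oddPeg (x ∷ [])    odd oY = push-oddPeg (0 , _) (odd fzero refl) oY
potential-oddPeg (x ∷ _ ∷ s) odd oY =
  push-oddPeg (potential s _) (odd fzero refl) (potential-oddPeg s (oddDiscs-drop₂ odd) oY)

-- How the potentials a (before) and b (after) of the discs larger than an odd disc compare
-- when that disc moves between the two odd pegs other than r.  Pushing a disc that lies on r
-- preserves the relation, and every odd disc smaller than the moving one does lie on r.
data Shift (r : Peg) : ℕ × Peg → ℕ × Peg → Set where
  up   : ∀ {D T} → OddPeg T → T ≢ r → Shift r (D , T) (suc D , r)
  down : ∀ {D T} → OddPeg T → T ≢ r → Shift r (suc D , r) (D , T)
  flat : ∀ {D T T′} → OddPeg T → OddPeg T′ → T ≢ r → T′ ≢ r → Shift r (D , T) (D , T′)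

shift-≤ : ∀ {r a b} → Shift r a b → proj₁ a ≤ suc (proj₁ b)
shift-≤ (up _ _)       = m≤n⇒m≤1+n (n≤1+n _)
shift-≤ (down _ _)     = ≤-refl
shift-≤ (flat _ _ _ _) = n≤1+n _

shift-start : ∀ {p q} → OddPeg p → OddPeg q → p ≢ q → (a : ℕ × Peg) → OddPeg (proj₂ a) →
              Shift (third p q) (push p a) (push q a)
shift-start {p} {q} op oq p≢q (m , Z) oZ with ≢-third op oq p≢q | oddPeg-cases op oq p≢q oZ
... | p≢r , _ | inj₁ refl rewrite push-≡ p m | push-≢ m (≢-sym p≢q) | third-comm oq op = up op p≢r
... | _ , q≢r | inj₂ (inj₁ refl) rewrite push-≡ q m | push-≢ m p≢q = down oq q≢r
... | p≢r , q≢r | inj₂ (inj₂ refl) rewrite push-≢ m p≢r | push-≢ m q≢r =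
  flat (third-oddPeg op oZ) (third-oddPeg oq oZ)
       (≢-sym (proj₂ (≢-third op oZ p≢r))) (≢-sym (proj₂ (≢-third oq oZ q≢r)))

shift-push : ∀ {r a b} → OddPeg r → Shift r a b → Shift r (push r a) (push r b)
shift-push {r} or (up {D} oT T≢r) with ≢-third or oT (≢-sym T≢r)
... | r≢t , _ rewrite push-≢ D (≢-sym T≢r) | push-≡ r (suc D) | *-suc 2 D =
  up (third-oddPeg or oT) (≢-sym r≢t)
shift-push {r} or (down {D} oT T≢r) with ≢-third or oT (≢-sym T≢r)
... | r≢t , _ rewrite push-≢ D (≢-sym T≢r) | push-≡ r (suc D) | *-suc 2 D =
  down (third-oddPeg or oT) (≢-sym r≢t)
shift-push {r} or (flat {D} oT oT′ T≢r T′≢r)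
  with ≢-third or oT (≢-sym T≢r) | ≢-third or oT′ (≢-sym T′≢r)
... | r≢t , _ | r≢t′ , _ rewrite push-≢ D (≢-sym T≢r) | push-≢ D (≢-sym T′≢r) =
  flat (third-oddPeg or oT) (third-oddPeg or oT′) (≢-sym r≢t) (≢-sym r≢t′)

clear-drop₂ : ∀ {n x y d p} {s : State n} → Clear (x ∷ y ∷ s) (fsuc (fsuc d)) p → Clear s d p
clear-drop₂ clear e e<d = clear (fsuc (fsuc e)) (s≤s (s≤s e<d))

odd-move-shift : ∀ {n} (s : State n) {d q} Y → parity (toℕ d) ≡ false →
  OddDiscsOnOddPegs s → OddPeg q → OddPeg Y →
  lookup s d ≢ q → Clear s d (lookup s d) → Clear s d q →
  Shift (third (lookup s d) q) (potential s Y) (potential (s [ d ]≔ q) Y)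
odd-move-shift (x ∷ [])    {fzero} Y _ odd oq oY x≢q _ _ = shift-start (odd fzero refl) oq x≢q (0 , Y) oY
odd-move-shift (x ∷ _ ∷ s) {fzero} Y _ odd oq oY x≢q _ _ =
  shift-start (odd fzero refl) oq x≢q (potential s Y) (potential-oddPeg s (oddDiscs-drop₂ odd) oY)
odd-move-shift (x ∷ _ ∷ s) {fsuc fzero} Y ()
odd-move-shift (x ∷ _ ∷ s) {fsuc (fsuc d)} Y h odd oq oY p≢q clearP clearQ
  with oddPeg-cases (oddDiscs-drop₂ odd d (parity-drop₂ d h)) oq p≢q (odd fzero refl)
... | inj₁ x≡p         = ⊥-elim (clearP fzero (s≤s z≤n) x≡p)
... | inj₂ (inj₁ x≡q)  = ⊥-elim (clearQ fzero (s≤s z≤n) x≡q)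
... | inj₂ (inj₂ refl) = shift-push (odd fzero refl)
  (odd-move-shift s Y (parity-drop₂ d h) (oddDiscs-drop₂ odd) oq oY p≢q (clear-drop₂ clearP) (clear-drop₂ clearQ))

even-move-potential : ∀ {n} (s : State n) {d} q Y → parity (toℕ d) ≡ true →
                      potential (s [ d ]≔ q) Y ≡ potential s Y
even-move-potential (x ∷ [])    {fzero}        q Y ()
even-move-potential (x ∷ _ ∷ s) {fzero}        q Y ()
even-move-potential (x ∷ _ ∷ s) {fsuc fzero}   q Y _ = refl
even-move-potential (x ∷ _ ∷ s) {fsuc (fsuc d)} q Y h = cong (push x) (even-move-potential s q Y (parity-drop₂ d h))

oddDiscs-move : ∀ {n} {s t : State n} → Move s t → OddDiscsOnOddPegs s → OddDiscsOnOddPegs t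
oddDiscs-move {s = s} (move d q _ ok _ _ refl) odd i h with i Fin.≟ d
... | yes refl = subst OddPeg (sym (lookup∘update d s q)) (subst (λ e → PegFor e q) h (pegFor q ok))
... | no  i≢d  = subst OddPeg (sym (lookup∘update′ i≢d s q)) (odd i h)

move-distance : ∀ {n} {s t : State n} {Y} → Move s t → OddDiscsOnOddPegs s → OddPeg Y →
                distance s Y ≤ suc (distance t Y)
move-distance {s = s} {Y = Y} (move d q s≢q ok clearP clearQ refl) odd oY with parity (toℕ d) in h
... | true  = subst (λ a → distance s Y ≤ suc (proj₁ a)) (sym (even-move-potential s q Y h)) (n≤1+n _)
... | false = shift-≤ (odd-move-shift s Y h odd (subst (λ e → PegFor e q) h (pegFor q ok)) oY s≢q clearP clearQ)

moves-distance : ∀ {n k} {s u : State n} {Y} → Moves k s u → OddDiscsOnOddPegs s → OddPeg Y →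
                 distance s Y ≤ k + distance u Y
moves-distance done          _   _  = ≤-refl
moves-distance (step m ms) odd oY =
  ≤-trans (move-distance m odd oY) (s≤s (moves-distance ms (oddDiscs-move m odd) oY))

TowerOnN₁ : ℕ → ℕ × Peg → Set
TowerOnN₁ c a = suc (proj₁ a) ≡ 2 ^ c × OddPeg (proj₂ a) × proj₂ a ≢ N₁

push-N₁ : ∀ {c} a → TowerOnN₁ c a → TowerOnN₁ (suc c) (push N₁ a)
push-N₁ (D , T) (2^c , oT , T≢N₁) with ≢-third at-N₁ oT (≢-sym T≢N₁)
... | N₁≢r , _ rewrite push-≢ D (≢-sym T≢N₁) =
  trans (sym (*-suc 2 D)) (cong (2 *_) 2^c) , third-oddPeg at-N₁ oT , ≢-sym N₁≢r

tower-potential : ∀ n {Y} → OddPeg Y → Y ≢ N₁ → TowerOnN₁ ⌈ n /2⌉ (potential (replicate n N₁) Y)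
tower-potential zero          oY Y≢N₁ = refl , oY , Y≢N₁
tower-potential (suc zero)    oY Y≢N₁ = push-N₁ {0} (0 , _) (refl , oY , Y≢N₁)
tower-potential (suc (suc n)) oY Y≢N₁ =
  push-N₁ {⌈ n /2⌉} (potential (replicate n N₁) _) (tower-potential n oY Y≢N₁)

potential-solved : ∀ {n} (s : State n) Y → (∀ i → parity (toℕ i) ≡ false → lookup s i ≡ Y) →
                   potential s Y ≡ (0 , Y)
potential-solved []          Y _   = refl
potential-solved (x ∷ [])    Y onY rewrite onY fzero refl = push-≡ Y 0
potential-solved (x ∷ _ ∷ s) Y onY
  rewrite onY fzero refl | potential-solved s Y (λ i h → onY (fsuc (fsuc i)) (trans (parity-suc² (toℕ i)) h))
  = push-≡ Y 0

oddTarget : ∀ g → OddPeg (targetPeg g false) × targetPeg g false ≢ N₁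
oddTarget goalA = at-N₂ , λ ()
oddTarget goalB = at-O  , λ ()
oddTarget goalC = at-O  , λ ()
oddTarget goalD = at-N₂ , λ ()

lower-bound : ∀ g n {k} → Moves k (start n) (target g n) → 2 ^ ⌈ n /2⌉ ≤ suc k
lower-bound g n {k} ms = begin
  2 ^ ⌈ n /2⌉                           ≡⟨ sym (proj₁ (tower-potential n oY Y≢N₁)) ⟩
  suc (distance (start n) Y)            ≤⟨ s≤s (moves-distance ms start-odd oY) ⟩
  suc (k + distance (target g n) Y)     ≡⟨ cong (λ a → suc (k + proj₁ a)) (potential-solved (target g n) Y on-Y) ⟩
  suc (k + 0)                           ≡⟨ cong suc (+-identityʳ k) ⟩
  suc k                                 ∎
  where
  open ≤-Reasoning hiding (start)
  Y = targetPeg g false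
  oY = proj₁ (oddTarget g)
  Y≢N₁ = proj₂ (oddTarget g)
  start-odd : OddDiscsOnOddPegs (start n)
  start-odd i _ = subst OddPeg (sym (lookup-replicate i N₁)) at-N₁
  on-Y : ∀ i → parity (toℕ i) ≡ false → lookup (target g n) i ≡ Y
  on-Y i h = trans (lookup∘tabulate _ i) (cong (targetPeg g) h)

-- Upper bound: moving one parity class while the other rests at home

home : Bool → Peg
home true  = E
home false = O

pegFor-home : ∀ {e} b → PegFor e (home b) → b ≡ e
pegFor-home true  at-E = refl
pegFor-home false at-O = refl

home-≢ : ∀ {e b X} → PegFor e X → b ≢ e → X ≢ home b
home-≢ {b = b} pX b≢e refl = b≢e (pegFor-home b pX)

record Triple (e : Bool) (X Y Z : Peg) : Set where
  field
    X≢Y : X ≢ Y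
    X≢Z : X ≢ Z
    Y≢Z : Y ≢ Z
    forX : PegFor e X
    forY : PegFor e Y
    forZ : PegFor e Z

swap₁₂ : ∀ {e X Y Z} → Triple e X Y Z → Triple e Y X Z
swap₁₂ t = record { X≢Y = ≢-sym X≢Y ; X≢Z = Y≢Z ; Y≢Z = X≢Z ; forX = forY ; forY = forX ; forZ = forZ }
  where open Triple t

swap₂₃ : ∀ {e X Y Z} → Triple e X Y Z → Triple e X Z Y
swap₂₃ t = record { X≢Y = X≢Z ; X≢Z = X≢Y ; Y≢Z = ≢-sym Y≢Z ; forX = forX ; forY = forZ ; forZ = forY }
  where open Triple t

swap₁₃ : ∀ {e X Y Z} → Triple e X Y Z → Triple e Z Y X
swap₁₃ = swap₁₂ ∘ swap₂₃ ∘ swap₁₂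

home-triple : ∀ e → Triple e (home e) N₁ N₂
home-triple true  = record { X≢Y = λ () ; X≢Z = λ () ; Y≢Z = λ () ; forX = at-E ; forY = at-N₁ ; forZ = at-N₂ }
home-triple false = record { X≢Y = λ () ; X≢Z = λ () ; Y≢Z = λ () ; forX = at-O ; forY = at-N₁ ; forZ = at-N₂ }

InClass : ∀ {n} → Bool → ℕ → Fin n → Set
InClass e m i = toℕ i < m × parity (toℕ i) ≡ e

ClassOn : ∀ {n} → Bool → ℕ → Peg → State n → Set
ClassOn e m X s = ∀ i → InClass e m i → lookup s i ≡ X

OthersHome : ∀ {n} → Bool → ℕ → State n → Set
OthersHome e m s = ∀ i → toℕ i < m → parity (toℕ i) ≢ e → lookup s i ≡ home (parity (toℕ i))

record Relocation {n} (c : ℕ) (e : Bool) (m : ℕ) (Y : Peg) (s : State n) : Set where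
  field
    final : State n
    moves : Moves c s final
    onY   : ClassOn e m Y final
    frame : ∀ i → ¬ InClass e m i → lookup final i ≡ lookup s i

-- The other discs among the first m rest at home, which is none of X, Y, Z: they never block.
Transfer : ℕ → Bool → ℕ → ℕ → Set
Transfer c e m n = ∀ {X Y Z} → Triple e X Y Z → (s : State n) → ClassOn e m X s → OthersHome e m s →
                   Relocation c e m Y s

widen : ∀ {n e m} {i : Fin n} → InClass e m i → InClass e (suc m) i
widen (i<m , p) = m<n⇒m<1+n i<m , p

narrow : ∀ {n e m} {i : Fin n} → InClass e (suc m) i → InClass e m i ⊎ toℕ i ≡ m
narrow (i<1+m , p) with m<1+n⇒m<n∨m≡n i<1+m
... | inj₁ i<m = inj₁ (i<m , p)
... | inj₂ i≡m = inj₂ i≡m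

below-≢ : ∀ {n m} {i d : Fin n} → toℕ i < m → toℕ d ≡ m → i ≢ d
below-≢ i<m d≡m refl = <-irrefl d≡m i<m

transfer-skip : ∀ {n c e m} → parity m ≡ not e → Transfer c e m n → Transfer c e (suc m) n
transfer-skip {e = e} {m} m∉ T tr s onX others = record
  { final = R.final ; moves = R.moves ; onY = λ i → R.onY i ∘ shrink ; frame = λ i ∉ → R.frame i (∉ ∘ widen) }
  where
  module R = Relocation (T tr s (λ i → onX i ∘ widen) (λ i → others i ∘ m<n⇒m<1+n))
  shrink : ∀ {i} → InClass e (suc m) i → InClass e m i
  shrink c with narrow c
  ... | inj₁ c′  = c′
  ... | inj₂ i≡m = ⊥-elim (not-¬ (trans (cong parity (sym i≡m)) (proj₂ c)) m∉)

-- The classical recursion: the smaller class goes X → Z, disc d goes X → Y, then the class Z → Y.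
transfer-step : ∀ {n c e m} (d : Fin n) → toℕ d ≡ m → parity m ≡ e → Transfer c e m n →
                Transfer (c + suc c) e (suc m) n
transfer-step {e = e} {m} d d≡m pd T {X} {Y} {Z} tr s onX others = record
  { final = R₂.final ; moves = R₁.moves ++ᴹ step hop R₂.moves ; onY = onY ; frame = frame }
  where
  open Triple tr
  module R₁ = Relocation (T (swap₂₃ tr) s (λ i → onX i ∘ widen) (λ i → others i ∘ m<n⇒m<1+n))
  d∉ : ¬ InClass e m d
  d∉ (d<m , _) = <-irrefl d≡m d<m
  d∈ : InClass e (suc m) d
  d∈ = ≤-reflexive (cong suc d≡m) , trans (cong parity d≡m) pd
  d-on-X : lookup R₁.final d ≡ X
  d-on-X = trans (R₁.frame d d∉) (onX d d∈)
  below : ∀ {i} → toℕ i < toℕ d → toℕ i < m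
  below = subst (_ <_) d≡m
  clear : ∀ {P} → PegFor e P → Z ≢ P → Clear R₁.final d P
  clear pP Z≢P i i<d with parity (toℕ i) Bool.≟ e
  ... | yes p = λ i-on-P → Z≢P (trans (sym (R₁.onY i (below i<d , p))) i-on-P)
  ... | no ¬p = λ i-on-P → home-≢ pP ¬p
    (trans (sym i-on-P) (trans (R₁.frame i (¬p ∘ proj₂)) (others i (m<n⇒m<1+n (below i<d)) ¬p)))
  hop : Move R₁.final (R₁.final [ d ]≔ Y)
  hop = move d Y (λ d-on-Y → X≢Y (trans (sym d-on-X) d-on-Y)) (allowed forY (proj₂ d∈))
    (subst (Clear R₁.final d) (sym d-on-X) (clear forX (≢-sym X≢Z))) (clear forY (≢-sym Y≢Z)) refl
  module R₂ = Relocation (T (swap₁₃ tr) (R₁.final [ d ]≔ Y)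
    (λ i c → trans (lookup∘update′ (below-≢ (proj₁ c) d≡m) R₁.final Y) (R₁.onY i c))
    (λ i i<m ¬p → trans (lookup∘update′ (below-≢ i<m d≡m) R₁.final Y)
                        (trans (R₁.frame i (¬p ∘ proj₂)) (others i (m<n⇒m<1+n i<m) ¬p))))
  onY : ClassOn e (suc m) Y R₂.final
  onY i c with narrow c
  ... | inj₁ c′  = R₂.onY i c′
  ... | inj₂ i≡m with toℕ-injective (trans i≡m (sym d≡m))
  ...   | refl = trans (R₂.frame d d∉) (lookup∘update d R₁.final Y)
  frame : ∀ i → ¬ InClass e (suc m) i → lookup R₂.final i ≡ lookup s i
  frame i ∉ = trans (R₂.frame i (∉ ∘ widen))
    (trans (lookup∘update′ (λ { refl → ∉ d∈ }) R₁.final Y) (R₁.frame i (∉ ∘ widen)))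

-- towerCost e m = 2 ^ (number of discs of evenness e among the first m) − 1: a new disc
-- doubles the tower (plus one move) exactly when its evenness is e.
addDisc : Bool → Bool → ℕ → ℕ
addDisc true  true  c = c + suc c
addDisc false false c = c + suc c
addDisc true  false c = c
addDisc false true  c = c

towerCost : Bool → ℕ → ℕ
towerCost e zero    = 0
towerCost e (suc m) = addDisc (parity m) e (towerCost e m)

transfer-extend : ∀ {n c e m} b (d : Fin n) → toℕ d ≡ m → parity m ≡ b → Transfer c e m n →
                  Transfer (addDisc b e c) e (suc m) n
transfer-extend {e = true}  true  d d≡m p = transfer-step d d≡m p
transfer-extend {e = false} false d d≡m p = transfer-step d d≡m p
transfer-extend {e = false} true  _ _   p = transfer-skip p
transfer-extend {e = true}  false _ _   p = transfer-skip p

transfer : ∀ {n} e m → m ≤ n → Transfer (towerCost e m) e m n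
transfer e zero    _   _ s _ _ = record { final = s ; moves = done ; onY = λ _ () ; frame = λ _ _ → refl }
transfer e (suc m) m<n =
  transfer-extend (parity m) (fromℕ< m<n) (toℕ-fromℕ< m<n) refl (transfer e m (<⇒≤ m<n))

record Settled {n} (k : ℕ) (b : Peg) (s : State n) : Set where
  field
    settled : ∀ i → toℕ i < k → lookup s i ≡ home (parity (toℕ i))
    waiting : ∀ i → k ≤ toℕ i → lookup s i ≡ b

stepCost : ℕ → ℕ
stepCost k = towerCost (parity k) k + towerCost (parity k) (suc k)

other-below : ∀ {k i} → i < suc k → parity i ≢ parity k → i < k
other-below {k} i<1+k ¬p with m<1+n⇒m<n∨m≡n i<1+k
... | inj₁ i<k = i<k
... | inj₂ refl = ⊥-elim (¬p refl)

-- The smaller discs of disc k's parity are parked on N₁, on top of disc k, and then the whole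
-- class up to k is transferred home.
settle-step : ∀ {n k} {s : State n} → k < n → Settled k N₁ s →
              ∃ λ t → Moves (stepCost k) s t × Settled (suc k) N₁ t
settle-step {n} {k} {s} k<n h =
  R₂.final , R₁.moves ++ᴹ R₂.moves , record { settled = settled′ ; waiting = waiting′ }
  where
  open Settled h
  e = parity k
  module R₁ = Relocation (transfer e k (<⇒≤ k<n) (home-triple e) s
    (λ i (i<k , p) → trans (settled i i<k) (cong home p)) (λ i i<k _ → settled i i<k))
  k∉ : ∀ {i : Fin n} → toℕ i ≡ k → ¬ InClass e k i
  k∉ i≡k (i<k , _) = <-irrefl i≡k i<k
  module R₂ = Relocation (transfer e (suc k) k<n (swap₁₂ (home-triple e)) R₁.final
    (λ i c → [ R₁.onY i , (λ i≡k → trans (R₁.frame i (k∉ i≡k)) (waiting i (≤-reflexive (sym i≡k)))) ]′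
               (narrow c))
    (λ i i<1+k ¬p → trans (R₁.frame i (¬p ∘ proj₂)) (settled i (other-below i<1+k ¬p))))
  settled′ : ∀ i → toℕ i < suc k → lookup R₂.final i ≡ home (parity (toℕ i))
  settled′ i i<1+k with parity (toℕ i) Bool.≟ e
  ... | yes p = trans (R₂.onY i (i<1+k , p)) (cong home (sym p))
  ... | no ¬p = trans (R₂.frame i (¬p ∘ proj₂))
                      (trans (R₁.frame i (¬p ∘ proj₂)) (settled i (other-below i<1+k ¬p)))
  waiting′ : ∀ i → suc k ≤ toℕ i → lookup R₂.final i ≡ N₁
  waiting′ i k<i = trans (R₂.frame i (λ (i<1+k , _) → <⇒≱ i<1+k k<i))
    (trans (R₁.frame i (λ (i<k , _) → <⇒≱ i<k (<⇒≤ k<i))) (waiting i (<⇒≤ k<i)))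

-- Mirror image towards N₂: the class up to k leaves home for N₂, then the smaller discs return.
unsettle-step : ∀ {n k} {s : State n} → k < n → Settled (suc k) N₂ s →
                ∃ λ t → Moves (stepCost k) s t × Settled k N₂ t
unsettle-step {n} {k} {s} k<n h =
  R₂.final ,
  subst (λ c → Moves c s R₂.final) (+-comm (towerCost e (suc k)) (towerCost e k)) (R₁.moves ++ᴹ R₂.moves) ,
  record { settled = settled′ ; waiting = waiting′ }
  where
  open Settled h
  e = parity k
  module R₁ = Relocation (transfer e (suc k) k<n (swap₂₃ (home-triple e)) s
    (λ i (i<1+k , p) → trans (settled i i<1+k) (cong home p)) (λ i i<1+k _ → settled i i<1+k))
  module R₂ = Relocation (transfer e k (<⇒≤ k<n) (swap₁₂ (swap₂₃ (home-triple e))) R₁.final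
    (λ i c → R₁.onY i (widen c))
    (λ i i<k ¬p → trans (R₁.frame i (¬p ∘ proj₂)) (settled i (m<n⇒m<1+n i<k))))
  settled′ : ∀ i → toℕ i < k → lookup R₂.final i ≡ home (parity (toℕ i))
  settled′ i i<k with parity (toℕ i) Bool.≟ e
  ... | yes p = trans (R₂.onY i (i<k , p)) (cong home (sym p))
  ... | no ¬p = trans (R₂.frame i (¬p ∘ proj₂))
                      (trans (R₁.frame i (¬p ∘ proj₂)) (settled i (m<n⇒m<1+n i<k)))
  waiting′ : ∀ i → k ≤ toℕ i → lookup R₂.final i ≡ N₂
  waiting′ i k≤i with m≤n⇒m<n∨m≡n k≤i
  ... | inj₁ k<i = trans (R₂.frame i (λ (i<k , _) → <⇒≱ i<k k≤i))
    (trans (R₁.frame i (λ (i<1+k , _) → <⇒≱ i<1+k k<i)) (waiting i k<i))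
  ... | inj₂ refl = trans (R₂.frame i (λ (i<k , _) → <-irrefl refl i<k)) (R₁.onY i (≤-refl , refl))

settleCost : ℕ → ℕ
settleCost zero    = 0
settleCost (suc k) = settleCost k + stepCost k

settle : ∀ {n} k → k ≤ n → {s : State n} → Settled 0 N₁ s →
         ∃ λ t → Moves (settleCost k) s t × Settled k N₁ t
settle zero    _   {s} h = s , done , h
settle (suc k) k<n h with settle k (<⇒≤ k<n) h
... | s₁ , ms₁ , h₁ with settle-step k<n h₁
...   | t , ms₂ , h₂ = t , ms₁ ++ᴹ ms₂ , h₂

unsettle : ∀ {n} k → k ≤ n → {s : State n} → Settled k N₂ s →
           ∃ λ t → Moves (settleCost k) s t × Settled 0 N₂ t
unsettle zero    _   {s} h = s , done , h
unsettle (suc k) k<n {s} h with unsettle-step k<n h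
... | s₁ , ms₁ , h₁ with unsettle k (<⇒≤ k<n) h₁
...   | t , ms₂ , h₂ = t , subst (λ c → Moves c s t) (+-comm (stepCost k) (settleCost k)) (ms₁ ++ᴹ ms₂) , h₂

start-settled : ∀ n → Settled 0 N₁ (start n)
start-settled n = record { settled = λ _ () ; waiting = λ i _ → lookup-replicate i N₁ }

homes : ∀ n → ∃ λ t → Moves (settleCost n) (start n) t × Settled n N₁ t
homes n = settle n ≤-refl (start-settled n)

at-home : ∀ {n b} {s : State n} → Settled n b s → ∀ i → lookup s i ≡ home (parity (toℕ i))
at-home h i = Settled.settled h i (toℕ<n i)

resettled : ∀ {n b b′} {s : State n} → Settled n b s → Settled n b′ s
resettled h = record { settled = Settled.settled h ; waiting = λ i n≤i → ⊥-elim (<⇒≱ (toℕ<n i) n≤i) }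

gather : ∀ {n} e g → targetPeg g e ≡ N₂ → targetPeg g (not e) ≡ home (not e) → {s : State n} →
         Settled n N₁ s → Moves (towerCost e n) s (target g n)
gather {n} e g e↦N₂ ¬e↦home {s} h = arrive R.moves final
  where
  module R = Relocation (transfer e n ≤-refl (swap₂₃ (home-triple e)) s
    (λ i (_ , p) → trans (at-home h i) (cong home p)) (λ i _ _ → at-home h i))
  final : ∀ i → lookup R.final i ≡ targetPeg g (parity (toℕ i))
  final i with parity (toℕ i) Bool.≟ e
  ... | yes p = trans (R.onY i (toℕ<n i , p)) (sym (trans (cong (targetPeg g) p) e↦N₂))
  ... | no ¬p = trans (R.frame i (¬p ∘ proj₂))
    (trans (at-home h i) (trans (cong home (¬-not ¬p)) (sym (trans (cong (targetPeg g) (¬-not ¬p)) ¬e↦home))))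

routeCost : Goal → ℕ → ℕ
routeCost goalA n = settleCost n + settleCost n
routeCost goalB n = settleCost n
routeCost goalC n = settleCost n + towerCost true n
routeCost goalD n = settleCost n + towerCost false n

route : ∀ g n → Moves (routeCost g n) (start n) (target g n)
route goalA n with homes n
... | t , ms , h with unsettle n ≤-refl (resettled h)
...   | u , ms′ , h′ = arrive (ms ++ᴹ ms′) (λ i → Settled.waiting h′ i z≤n)
route goalB n with homes n
... | t , ms , h = arrive ms λ i → trans (at-home h i) (home-targetB (parity (toℕ i)))
  where
  home-targetB : ∀ b → home b ≡ targetPeg goalB b
  home-targetB true  = refl
  home-targetB false = refl
route goalC n with homes n
... | t , ms , h = ms ++ᴹ gather true goalC refl refl h
route goalD n with homes n
... | t , ms , h = ms ++ᴹ gather false goalD refl refl h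

-- Move counts

m+1+m≡1+2m : ∀ m → m + suc m ≡ suc (2 * m)
m+1+m≡1+2m m = trans (+-suc m m) (cong (λ x → suc (m + x)) (sym (+-identityʳ m)))

addDisc-twice : ∀ b e c → addDisc (not b) e (addDisc b e c) ≡ suc (2 * c)
addDisc-twice true  true  c = m+1+m≡1+2m c
addDisc-twice true  false c = m+1+m≡1+2m c
addDisc-twice false true  c = m+1+m≡1+2m c
addDisc-twice false false c = m+1+m≡1+2m c

towerCost-< : ∀ e m → towerCost e m < 2 ^ ⌈ m /2⌉
towerCost-< e     zero          = s≤s z≤n
towerCost-< true  (suc zero)    = s≤s z≤n
towerCost-< false (suc zero)    = s≤s (s≤s z≤n)
towerCost-< e     (suc (suc m)) = begin
  suc (towerCost e (suc (suc m)))  ≡⟨ cong suc (addDisc-twice (parity m) e (towerCost e m)) ⟩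
  suc (suc (2 * towerCost e m))    ≡⟨ *-suc 2 (towerCost e m) ⟨
  2 * suc (towerCost e m)          ≤⟨ *-monoʳ-≤ 2 (towerCost-< e m) ⟩
  2 * 2 ^ ⌈ m /2⌉                  ∎
  where open ≤-Reasoning hiding (start)

2^⌈1+n/2⌉≤2*2^⌈n/2⌉ : ∀ n → 2 ^ ⌈ suc n /2⌉ ≤ 2 * 2 ^ ⌈ n /2⌉
2^⌈1+n/2⌉≤2*2^⌈n/2⌉ n = ^-monoʳ-≤ 2 (s≤s (⌊n/2⌋≤⌈n/2⌉ n))

stepCost-≤ : ∀ k → stepCost k ≤ 3 * 2 ^ ⌈ k /2⌉
stepCost-≤ k = +-mono-≤ (<⇒≤ (towerCost-< (parity k) k))
                        (≤-trans (<⇒≤ (towerCost-< (parity k) (suc k))) (2^⌈1+n/2⌉≤2*2^⌈n/2⌉ k))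

settleCost-≤ : ∀ k → settleCost k ≤ 9 * 2 ^ ⌈ k /2⌉
settleCost-≤ zero          = z≤n
settleCost-≤ (suc zero)    = s≤s z≤n
settleCost-≤ (suc (suc k)) = begin
  settleCost k + stepCost k + stepCost (suc k)
    ≤⟨ +-mono-≤ (+-mono-≤ (settleCost-≤ k) (stepCost-≤ k))
                (≤-trans (stepCost-≤ (suc k)) (*-monoʳ-≤ 3 (2^⌈1+n/2⌉≤2*2^⌈n/2⌉ k))) ⟩
  9 * B + 3 * B + 3 * (2 * B)   ≡⟨ regroup B ⟩
  9 * (2 * B)                   ∎
  where
  open ≤-Reasoning hiding (start)
  B = 2 ^ ⌈ k /2⌉
  regroup : ∀ x → 9 * x + 3 * x + 3 * (2 * x) ≡ 9 * (2 * x)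
  regroup = solve-∀

a+b≤18* : ∀ B {a b} → a ≤ 9 * B → b ≤ 9 * B → a + b ≤ 18 * B
a+b≤18* B {a} {b} a≤ b≤ = subst (a + b ≤_) (sym (*-distribʳ-+ B 9 9)) (+-mono-≤ a≤ b≤)

routeCost-≤ : ∀ g n → routeCost g n ≤ 18 * 2 ^ ⌈ n /2⌉
routeCost-≤ goalA n = a+b≤18* (2 ^ ⌈ n /2⌉) (settleCost-≤ n) (settleCost-≤ n)
routeCost-≤ goalB n = ≤-trans (m≤m+n (settleCost n) 0) (a+b≤18* (2 ^ ⌈ n /2⌉) (settleCost-≤ n) z≤n)
routeCost-≤ goalC n = a+b≤18* (2 ^ ⌈ n /2⌉) (settleCost-≤ n) (≤-trans (<⇒≤ (towerCost-< true n)) (m≤n*m _ 9))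
routeCost-≤ goalD n = a+b≤18* (2 ^ ⌈ n /2⌉) (settleCost-≤ n) (≤-trans (<⇒≤ (towerCost-< false n)) (m≤n*m _ 9))

2^n≤2^⌈n/2⌉*2^⌈n/2⌉ : ∀ n → 2 ^ n ≤ 2 ^ ⌈ n /2⌉ * 2 ^ ⌈ n /2⌉
2^n≤2^⌈n/2⌉*2^⌈n/2⌉ n = begin
  2 ^ n                         ≡⟨ cong (2 ^_) (⌊n/2⌋+⌈n/2⌉≡n n) ⟨
  2 ^ (⌊ n /2⌋ + ⌈ n /2⌉)       ≤⟨ ^-monoʳ-≤ 2 (+-monoˡ-≤ ⌈ n /2⌉ (⌊n/2⌋≤⌈n/2⌉ n)) ⟩
  2 ^ (⌈ n /2⌉ + ⌈ n /2⌉)       ≡⟨ ^-distribˡ-+-* 2 ⌈ n /2⌉ ⌈ n /2⌉ ⟩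
  2 ^ ⌈ n /2⌉ * 2 ^ ⌈ n /2⌉     ∎
  where open ≤-Reasoning hiding (start)

2^⌈n/2⌉*2^⌈n/2⌉≤2*2^n : ∀ n → 2 ^ ⌈ n /2⌉ * 2 ^ ⌈ n /2⌉ ≤ 2 * 2 ^ n
2^⌈n/2⌉*2^⌈n/2⌉≤2*2^n n = begin
  2 ^ ⌈ n /2⌉ * 2 ^ ⌈ n /2⌉     ≡⟨ ^-distribˡ-+-* 2 ⌈ n /2⌉ ⌈ n /2⌉ ⟨
  2 ^ (⌈ n /2⌉ + ⌈ n /2⌉)       ≤⟨ ^-monoʳ-≤ 2 (+-monoʳ-≤ ⌈ n /2⌉ (⌈n/2⌉-mono (n≤1+n n))) ⟩
  2 ^ (⌈ n /2⌉ + ⌈ suc n /2⌉)   ≡⟨ cong (2 ^_) (⌊n/2⌋+⌈n/2⌉≡n (suc n)) ⟩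
  2 * 2 ^ n                     ∎
  where open ≤-Reasoning hiding (start)

-- Existence of an optimum

any-peg? : ∀ {P : Peg → Set} → Decidable P → Dec (∃ P)
any-peg? P? with P? N₁ | P? E | P? O | P? N₂
... | yes p | _     | _     | _     = yes (N₁ , p)
... | no _  | yes p | _     | _     = yes (E , p)
... | no _  | no _  | yes p | _     = yes (O , p)
... | no _  | no _  | no _  | yes p = yes (N₂ , p)
... | no ¬a | no ¬b | no ¬c | no ¬d =
  no λ { (N₁ , p) → ¬a p ; (E , p) → ¬b p ; (O , p) → ¬c p ; (N₂ , p) → ¬d p }

allowed? : ∀ {n} (d : Fin n) q → Dec (Allowed d q)
allowed? d N₁ = yes tt
allowed? d E  = T? _
allowed? d O  = T? _
allowed? d N₂ = yes tt

clear? : ∀ {n} (s : State n) d p → Dec (Clear s d p)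
clear? s d p = all? λ e → toℕ e <? toℕ d →-dec ¬? (lookup s e ≟ p)

moves? : ∀ {n} k (s u : State n) → Dec (Moves k s u)
moves? zero s u with ≡-dec _≟_ s u
... | yes refl = yes done
... | no  s≢u  = no λ { done → s≢u refl }
moves? (suc k) s u with any? (λ d → any-peg? (λ q →
  ¬? (lookup s d ≟ q) ×-dec allowed? d q ×-dec clear? s d (lookup s d) ×-dec clear? s d q ×-dec
  moves? k (s [ d ]≔ q) u))
... | yes (d , q , s≢q , ok , clearP , clearQ , ms) = yes (step (move d q s≢q ok clearP clearQ refl) ms)
... | no ∄ =
  no λ { (step (move d q s≢q ok clearP clearQ refl) ms) → ∄ (d , q , s≢q , ok , clearP , clearQ , ms) }

module _ {P : ℕ → Set} (P? : Decidable P) where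

  least-or-none : ∀ m → (∀ j → j < m → ¬ P j) ⊎ ∃ λ k → P k × (∀ j → j < k → ¬ P j)
  least-or-none zero = inj₁ λ _ ()
  least-or-none (suc m) with least-or-none m
  ... | inj₂ least = inj₂ least
  ... | inj₁ none with P? m
  ...   | yes pm = inj₂ (m , pm , none)
  ...   | no ¬pm = inj₁ λ j j<1+m → [ none j , (λ { refl → ¬pm }) ]′ (m<1+n⇒m<n∨m≡n j<1+m)

  least : ∀ {m} → P m → ∃ λ k → P k × (∀ j → j < k → ¬ P j)
  least {m} pm with least-or-none (suc m)
  ... | inj₁ none  = ⊥-elim (none m ≤-refl pm)
  ... | inj₂ found = found

square-lower-bound : ∀ g n {k} → 1 ≤ n → Moves k (start n) (target g n) → 2 ^ n ≤ 4 * (k * k)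
square-lower-bound g n {k} 1≤n ms = begin
  2 ^ n                       ≤⟨ 2^n≤2^⌈n/2⌉*2^⌈n/2⌉ n ⟩
  2 ^ ⌈ n /2⌉ * 2 ^ ⌈ n /2⌉   ≤⟨ *-mono-≤ B≤2k B≤2k ⟩
  (2 * k) * (2 * k)           ≡⟨ interchange 2 k 2 k ⟩
  4 * (k * k)                 ∎
  where
  open ≤-Reasoning hiding (start)
  B≤1+k : 2 ^ ⌈ n /2⌉ ≤ suc k
  B≤1+k = lower-bound g n ms
  1≤k : 1 ≤ k
  1≤k = s≤s⁻¹ (≤-trans (^-monoʳ-≤ 2 (⌈n/2⌉-mono 1≤n)) B≤1+k)
  B≤2k : 2 ^ ⌈ n /2⌉ ≤ 2 * k
  B≤2k = ≤-trans B≤1+k (≤-trans (+-monoˡ-≤ k 1≤k) (≤-reflexive (cong (k +_) (sym (+-identityʳ k)))))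

square-upper-bound : ∀ g n {k} → (∀ j → j < k → ¬ Moves j (start n) (target g n)) → k * k ≤ 648 * 2 ^ n
square-upper-bound g n {k} minimal = begin
  k * k                 ≤⟨ *-mono-≤ k≤18B k≤18B ⟩
  (18 * B) * (18 * B)   ≡⟨ interchange 18 B 18 B ⟩
  324 * (B * B)         ≤⟨ *-monoʳ-≤ 324 (2^⌈n/2⌉*2^⌈n/2⌉≤2*2^n n) ⟩
  324 * (2 * 2 ^ n)     ≡⟨ *-assoc 324 2 (2 ^ n) ⟨
  648 * 2 ^ n           ∎
  where
  open ≤-Reasoning hiding (start)
  B = 2 ^ ⌈ n /2⌉
  k≤18B : k ≤ 18 * B
  k≤18B = ≤-trans (≮⇒≥ λ k>c → minimal _ k>c (route g n)) (routeCost-≤ g n)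

theorem5p5 : (g : Goal) →
    (∀ (n : ℕ) → ∃ λ k → Optimal g n k) ×
    (∃ λ (p : ℕ) → ∃ λ (q : ℕ) → ∃ λ (N : ℕ) →
      ∀ (n k : ℕ) → N ≤ n → Optimal g n k →
        (2 ^ n ≤ p * (k * k)) × (k * k ≤ q * 2 ^ n))
theorem5p5 g =
  (λ n → least (λ j → moves? j (start n) (target g n)) (route g n)) ,
  (4 , 648 , 1 , λ n k 1≤n (ms , minimal) →
     square-lower-bound g n 1≤n ms , square-upper-bound g n minimal)
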